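{- Let $\mathcal{O}=(E,\mathcal{L})$ be a simple oriented matroid of rank $r$ on a finite ground set $E$ with $|E|=n$, and let $R\in\{+\}^E$ be the all-plus sign vector. If for every $C\subseteq E$ with $|C|=r+1$ the sign vector $R\setminus(E\setminus C)$ is a covector of the contraction $\mathcal{O}/(E\setminus C)$, then $R$ is a covector of $\mathcal{O}$.
   Context: Sign vectors on a finite set $E$ are elements of $\{0,+,-\}^E$. For $X,Y$ the composition is $(X\circ Y)_e=X_e$ if $X_e\neq 0$ and $(X\circ Y)_e=Y_e$ otherwise; the separator is $S(X,Y)=\{e\in E: X_e=-Y_e\neq 0\}$. An oriented matroid (OM) is a pair $\mathcal{O}=(E,\mathcal{L})$, $\mathcal{L}\subseteq\{0,+,-\}^E$, containing the zero vector and satisfying (FS): for all $X,Y\in\mathcal{L}$, $X\circ(-Y)\in\mathcal{L}$; and (SE): for all $X,Y\in\mathcal{L}$ and $e\in S(X,Y)$ there is $Z\in\mathcal{L}$ with $Z_e=0$ and $Z_f=(X\circ Y)_f$ for all $f\in E\setminus S(X,Y)$. Elements of $\mathcal{L}$ are covectors. Simple means $\{X_e: X\in\mathcal{L}\}=\{+,-,0\}$ for every $e$ and $\{X_eX_f: X\in\mathcal{L}\}=\{+,-,0\}$ for all $e\neq f$. For $F\subseteq E$ and a sign vector $X$, $X\setminus F$ is $X$ restricted to the coordinates in $E\setminus F$, and $\mathcal{L}\setminus F=\{X\setminus F: X\in\mathcal{L}\}$. The contraction is $\mathcal{O}/F=(E\setminus F,\{X\setminus F: X\in\mathcal{L},\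 X_e=0\ \forall e\in F\})$. The rank is $r(\mathcal{O})=\max\{|A|: A\subseteq E,\ \mathcal{L}\setminus(E\setminus A)=\{0,+,-\}^{A}\}$. -}

module Defs where

open import Data.Nat using (ℕ; _≤_)
open import Data.Fin using (Fin)
open import Data.Fin.Subset using (Subset; _∈_; _∉_; ∣_∣; ∁)
open import Data.Vec using (Vec; lookup; zipWith; replicate)
open import Data.Product using (Σ; ∃; _×_)
open import Relation.Binary.PropositionalEquality using (_≡_; _≢_)
open import Relation.Nullary using (¬_)

data Sign : Set where
  zer pls mns : Sign

neg : Sign → Sign
neg zer = zer
neg pls = mns
neg mns = pls

_·_ : Sign → Sign → Sign
zer · _ = zer
pls · t = t
mns · t = neg t

SignVec : ℕ → Set
SignVec n = Vec Sign n

compS : Sign → Sign → Sign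
compS zer t = t
compS pls _ = pls
compS mns _ = mns

_∘ₛ_ : ∀ {n} → SignVec n → SignVec n → SignVec n
X ∘ₛ Y = zipWith compS X Y

negV : ∀ {n} → SignVec n → SignVec n
negV Y = Data.Vec.map neg Y

zeroV : ∀ {n} → SignVec n
zeroV = replicate _ zer

plusV : ∀ {n} → SignVec n
plusV = replicate _ pls

InSep : ∀ {n} → SignVec n → SignVec n → Fin n → Set
InSep X Y e = (lookup X e ≡ neg (lookup Y e)) × (lookup X e ≢ zer)

Covectors : ℕ → Set₁
Covectors n = SignVec n → Set

record IsOM {n : ℕ} (L : Covectors n) : Set where
  field
    zero∈ : L zeroV
    FS : ∀ X Y → L X → L Y → L (X ∘ₛ negV Y)
    SE : ∀ X Y → L X → L Y → ∀ e → InSep X Y e →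
         ∃ λ Z → L Z × (lookup Z e ≡ zer) ×
           (∀ f → ¬ InSep X Y f → lookup Z f ≡ lookup (X ∘ₛ Y) f)

record IsSimple {n : ℕ} (L : Covectors n) : Set where
  field
    single : ∀ (e : Fin n) (s : Sign) → ∃ λ X → L X × (lookup X e ≡ s)
    pair   : ∀ (e f : Fin n) → e ≢ f → (s : Sign) →
             ∃ λ X → L X × ((lookup X e · lookup X f) ≡ s)

-- L \ (E \ A) = {0,+,-}^A : every sign pattern on A is the restriction of a covector
FullOn : ∀ {n} → Covectors n → Subset n → Set
FullOn {n} L A = ∀ (Y : SignVec n) → ∃ λ X → L X × (∀ e → e ∈ A → lookup X e ≡ lookup Y e)

HasRank : ∀ {n} → Covectors n → ℕ → Set
HasRank {n} L r = (∃ λ (A : Subset n) → FullOn L A × (∣ A ∣ ≡ r))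
                × (∀ (A : Subset n) → FullOn L A → ∣ A ∣ ≤ r)

-- The sign vector Y \ F (Y restricted to E \ F) is a covector of the
-- contraction O / F, i.e. there is X ∈ L with X_e = 0 on F and X = Y off F.
-- (Coordinates of Y on F are ignored.)
InContraction : ∀ {n} → Covectors n → Subset n → SignVec n → Set
InContraction {n} L F Y = ∃ λ X → L X × (∀ e → e ∈ F → lookup X e ≡ zer)
                                      × (∀ e → e ∉ F → lookup X e ≡ lookup Y e)

-- Let A be an r-set on which every sign pattern is realised by a covector. If
-- A = E, then R itself is realised. Otherwise pick x ∉ A; every e ∈ E lies in
-- an (r+1)-set C (A ∪ {e}, or A ∪ {x} when e ∈ A), and the hypothesis yields a
-- covector that is + on C and 0 elsewhere. Composing these nonnegative covectors
-- over all e gives a covector, closed under composition by (FS), that is +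
-- everywhere.
module Submission where

open import Defs
open import Data.Nat using (ℕ; suc)
open import Data.Fin using (Fin; zero; suc)
open import Data.Fin.Subset using (Subset; _∈_; _∉_; ∣_∣; ∁; _∪_; ⁅_⁆; outside; inside)
open import Data.Fin.Subset.Properties
  using (_∈?_; nonempty?; x∈⁅x⁆; p⊆p∪q; q⊆p∪q; ∪-identityʳ; x∈p⇒x∉∁p; x∈∁p⇒x∉p; x∉∁p⇒x∈p)
open import Data.Vec using (Vec; _∷_; lookup)
open import Data.Vec.Properties using (lookup-zipWith; lookup-replicate; zipWith-identityˡ; map-∘; map-cong; map-id)
open import Data.Vec.Relation.Binary.Pointwise.Extensional using (ext; extensional⇒inductive)
open import Data.Vec.Relation.Binary.Pointwise.Inductive using (Pointwise-≡⇒≡)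
open import Data.List using (List; []; _∷_; foldr)
import Data.List as List
open import Data.List.Relation.Unary.All as All using (All; []; _∷_)
import Data.List.Relation.Unary.All.Properties as All
open import Data.List.Relation.Unary.Any using (Any; here; there)
import Data.List.Relation.Unary.Any.Properties as Any
open import Data.Vec.Base using (here; there)
open import Data.Product using (∃; _×_; _,_; proj₁; proj₂)
open import Function using (_∘_)
open import Relation.Nullary using (yes; no; contradiction)
open import Relation.Binary.PropositionalEquality using (_≡_; refl; sym; trans; cong; subst; module ≡-Reasoning)

private
  variable
    n : ℕ

≗-lookup⇒≡ : ∀ {A : Set} {xs ys : Vec A n} → (∀ i → lookup xs i ≡ lookup ys i) → xs ≡ ys
≗-lookup⇒≡ h = Pointwise-≡⇒≡ (extensional⇒inductive (ext h))

∣p∪⁅x⁆∣≡1+∣p∣ : ∀ {x : Fin n} {p : Subset n} → x ∉ p → ∣ p ∪ ⁅ x ⁆ ∣ ≡ suc ∣ p ∣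
∣p∪⁅x⁆∣≡1+∣p∣ {x = zero}  {outside ∷ p} _   = cong (suc ∘ ∣_∣) (∪-identityʳ p)
∣p∪⁅x⁆∣≡1+∣p∣ {x = zero}  {inside  ∷ p} x∉p = contradiction here x∉p
∣p∪⁅x⁆∣≡1+∣p∣ {x = suc x} {outside ∷ p} x∉p = ∣p∪⁅x⁆∣≡1+∣p∣ (x∉p ∘ there)
∣p∪⁅x⁆∣≡1+∣p∣ {x = suc x} {inside  ∷ p} x∉p = cong suc (∣p∪⁅x⁆∣≡1+∣p∣ (x∉p ∘ there))

∈-some-set-of-size-1+∣p∣ : ∀ {x : Fin n} {p : Subset n} → x ∉ p →
                           ∀ e → ∃ λ C → ∣ C ∣ ≡ suc ∣ p ∣ × e ∈ C
∈-some-set-of-size-1+∣p∣ {x = x} {p} x∉p e with e ∈? p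
... | yes e∈p = p ∪ ⁅ x ⁆ , ∣p∪⁅x⁆∣≡1+∣p∣ x∉p , p⊆p∪q ⁅ x ⁆ e∈p
... | no  e∉p = p ∪ ⁅ e ⁆ , ∣p∪⁅x⁆∣≡1+∣p∣ e∉p , q⊆p∪q p ⁅ e ⁆ (x∈⁅x⁆ e)

neg-involutive : ∀ s → neg (neg s) ≡ s
neg-involutive zer = refl
neg-involutive pls = refl
neg-involutive mns = refl

negV-involutive : (Y : SignVec n) → negV (negV Y) ≡ Y
negV-involutive Y = trans (sym (map-∘ neg neg Y)) (trans (map-cong neg-involutive Y) (map-id Y))

zeroV-∘ₛ : (Y : SignVec n) → zeroV ∘ₛ Y ≡ Y
zeroV-∘ₛ = zipWith-identityˡ (λ _ → refl)

data IsNonneg : Sign → Set where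
  zer-nonneg : IsNonneg zer
  pls-nonneg : IsNonneg pls

Nonnegative : SignVec n → Set
Nonnegative X = ∀ f → IsNonneg (lookup X f)

foldr-compS-nonneg≡pls : ∀ {ss} → All IsNonneg ss → Any (_≡ pls) ss → foldr compS zer ss ≡ pls
foldr-compS-nonneg≡pls (_          ∷ _)  (here refl) = refl
foldr-compS-nonneg≡pls (zer-nonneg ∷ ns) (there p)   = foldr-compS-nonneg≡pls ns p
foldr-compS-nonneg≡pls (pls-nonneg ∷ _)  (there _)   = refl

compose : List (SignVec n) → SignVec n
compose = foldr _∘ₛ_ zeroV

lookup-compose : (Xs : List (SignVec n)) (f : Fin n) →
                 lookup (compose Xs) f ≡ foldr compS zer (List.map (λ X → lookup X f) Xs)
lookup-compose []       f = lookup-replicate f zer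
lookup-compose (X ∷ Xs) f =
  trans (lookup-zipWith compS f X (compose Xs)) (cong (compS (lookup X f)) (lookup-compose Xs f))

compose-nonneg≡plusV : {Xs : List (SignVec n)} → All Nonnegative Xs →
                       (∀ f → Any (λ X → lookup X f ≡ pls) Xs) → compose Xs ≡ plusV
compose-nonneg≡plusV {Xs = Xs} nonneg covered = ≗-lookup⇒≡ λ f → begin
  lookup (compose Xs) f                             ≡⟨ lookup-compose Xs f ⟩
  foldr compS zer (List.map (λ X → lookup X f) Xs)  ≡⟨ foldr-compS-nonneg≡pls
                                                         (All.map⁺ (All.map (λ X≥0 → X≥0 f) nonneg))
                                                         (Any.map⁺ (covered f)) ⟩
  pls                                               ≡⟨ sym (lookup-replicate f pls) ⟩
  lookup plusV f                                    ∎
  where open ≡-Reasoning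

FullOn-⊤⇒L-total : ∀ {L : Covectors n} {A} → FullOn L A → (∀ e → e ∈ A) → ∀ Y → L Y
FullOn-⊤⇒L-total {L = L} {A} full ∈A Y = subst L (≗-lookup⇒≡ λ e → agree e (∈A e)) LX
  where
  LX : L (proj₁ (full Y))
  LX = proj₁ (proj₂ (full Y))
  agree : ∀ e → e ∈ A → lookup (proj₁ (full Y)) e ≡ lookup Y e
  agree = proj₂ (proj₂ (full Y))

InContraction-plusV⇒nonneg : ∀ {L : Covectors n} {C e} → InContraction L (∁ C) plusV → e ∈ C →
                             ∃ λ X → L X × Nonnegative X × lookup X e ≡ pls
InContraction-plusV⇒nonneg {C = C} {e} (X , LX , zero-off-C , plus-on-C) e∈C =
  X , LX , nonneg , plus (x∈p⇒x∉∁p e∈C)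
  where
  plus : ∀ {f} → f ∉ ∁ C → lookup X f ≡ pls
  plus {f} f∉∁C = trans (plus-on-C f f∉∁C) (lookup-replicate f pls)
  nonneg : Nonnegative X
  nonneg f with f ∈? ∁ C
  ... | yes f∈∁C = subst IsNonneg (sym (zero-off-C f f∈∁C)) zer-nonneg
  ... | no  f∉∁C = subst IsNonneg (sym (plus f∉∁C)) pls-nonneg

module _ {L : Covectors n} (om : IsOM L) where
  open IsOM om

  neg-closed : ∀ {Y} → L Y → L (negV Y)
  neg-closed {Y} LY = subst L (zeroV-∘ₛ (negV Y)) (FS zeroV Y zero∈ LY)

  ∘ₛ-closed : ∀ {X Y} → L X → L Y → L (X ∘ₛ Y)
  ∘ₛ-closed {X} {Y} LX LY = subst (λ Z → L (X ∘ₛ Z)) (negV-involutive Y) (FS X (negV Y) LX (neg-closed LY))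

  compose-closed : ∀ {Xs} → All L Xs → L (compose Xs)
  compose-closed []         = zero∈
  compose-closed (LX ∷ LXs) = ∘ₛ-closed LX (compose-closed LXs)

  nonneg-cover⇒plusV : (∀ e → ∃ λ X → L X × Nonnegative X × lookup X e ≡ pls) → L plusV
  nonneg-cover⇒plusV cover =
    subst L (compose-nonneg≡plusV (All.tabulate⁺ nonneg) (λ f → Any.tabulate⁺ f (positive f)))
            (compose-closed (All.tabulate⁺ covector))
    where
    X : Fin n → SignVec n
    X = proj₁ ∘ cover
    covector : ∀ e → L (X e)
    covector = proj₁ ∘ proj₂ ∘ cover
    nonneg : ∀ e → Nonnegative (X e)
    nonneg = proj₁ ∘ proj₂ ∘ proj₂ ∘ cover
    positive : ∀ e → lookup (X e) e ≡ pls
    positive = proj₂ ∘ proj₂ ∘ proj₂ ∘ cover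

mainTheorem3 : (n r : ℕ) (L : Covectors n) → IsOM L → IsSimple L → HasRank L r →
    (∀ (C : Subset n) → ∣ C ∣ ≡ suc r → InContraction L (∁ C) plusV) →
    L plusV
mainTheorem3 n r L om _ ((A , A-full , ∣A∣≡r) , _) contractions with nonempty? (∁ A)
... | no ∁A-empty = FullOn-⊤⇒L-total A-full (λ e → x∉∁p⇒x∈p (λ e∈∁A → ∁A-empty (e , e∈∁A))) plusV
... | yes (x , x∈∁A) = nonneg-cover⇒plusV om positive-at
  where
  positive-at : ∀ e → ∃ λ X → L X × Nonnegative X × lookup X e ≡ pls
  positive-at e with ∈-some-set-of-size-1+∣p∣ (x∈∁p⇒x∉p x∈∁A) e
  ... | C , ∣C∣≡1+∣A∣ , e∈C =
    InContraction-plusV⇒nonneg (contractions C (trans ∣C∣≡1+∣A∣ (cong suc ∣A∣≡r))) e∈C
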